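{- Let $\mathcal{B}$ be a base, $S$ an atomic multiset, $q$ an atom and $P=\{p_1,\dots,p_n\}$ an atomic multisets. The following are equivalent: (1) $P\uplus S\vdash_{\mathcal{B}}q$; (2) for every base $\mathcal{C}\supseteq\mathcal{B}$ and all atomic multisets $T_1,\dots,T_n$ with $T_i\vdash_{\mathcal{C}}p_i$ for each $i=1,\dots,n$, we have $T_1\uplus\dots\uplus T_n\uplus S\vdash_{\mathcal{C}}q$.
   Context: Fix a set $\mathbb{A}$ of atoms; multisets are finite, $\uplus$ is multiset union, an atomic multiset is a finite multiset of atoms. An atomic sequent is a pair $P\Rightarrow p$ ($P$ atomic multiset, $p$ atom); an atomic box is a finite multiset of atomic sequents; an atomic rule is a triple $\langle\mathbf{A},\mathbf{S},p\rangle$ with $\mathbf{A}$ a finite multiset of atomic boxes, $\mathbf{S}$ an atomic box, $p$ an atom. A base is a set of atomic rules; $\mathcal{C}\supseteq\mathcal{B}$ is set inclusion. An atom $p$ is persistent in $\mathcal{B}$ if $\mathcal{B}$ contains a rule $\langle\varnothing,\mathbf{S},p\rangle$ with $\mathbf{S}\neq\varnothing$. Derivability $P\vdash_{\mathcal{B}}p$ is the smallest relation closed under: (Ref) $\{p\}\vdash_{\mathcal{B}}p$; (App) if $\langle\mathbf{A},\mathbf{S},p\rangle\in\mathcal{B}$ with $\mathbf{A}=\{\mathbf{T}_1,\dots,\mathbf{T}_m\}$, and there are $n\ge m$, atomic multisets $C_1,\dots,C_n$ and a multiset $D=\{d_{m+1},\dots,d_n\}$ of atoms persistent in $\mathcal{B}$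 with $C_i\uplus Q\vdash_{\mathcal{B}}q$ for all $i\le m$ and $Q\Rightarrow q\in\mathbf{T}_i$, $C_j\vdash_{\mathcal{B}}d_j$ for all $m<j\le n$, and $D\uplus U\vdash_{\mathcal{B}}v$ for all $U\Rightarrow v\in\mathbf{S}$, then $C_1\uplus\dots\uplus C_n\vdash_{\mathcal{B}}p$. -}

module Defs where

open import Data.List using (List; []; _∷_; _++_; concat; map)
open import Data.List.Membership.Propositional using (_∈_)
open import Data.List.Relation.Unary.All using (All)
open import Data.List.Relation.Binary.Pointwise using (Pointwise)
open import Data.List.Relation.Binary.Permutation.Propositional using (_↭_)
open import Data.Product using (_×_; _,_; proj₁; proj₂; Σ; ∃)
open import Relation.Binary.PropositionalEquality using (_≢_)
open import Level using (suc; zero)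

-- Finite multisets are represented by lists; all notions below are
-- invariant under permutation (derivability is closed under _↭_ by
-- construction, and other uses are via list membership / indexing).

AMS : Set → Set
AMS Atom = List Atom

Sequent : Set → Set
Sequent Atom = AMS Atom × Atom

Box : Set → Set
Box Atom = List (Sequent Atom)

record Rule (Atom : Set) : Set where
  constructor ⟨_,_,_⟩
  field
    prems  : List (Box Atom)
    box    : Box Atom
    concl  : Atom

Base : Set → Set₁
Base Atom = Rule Atom → Set

_⊇_ : {Atom : Set} → Base Atom → Base Atom → Set
𝒞 ⊇ ℬ = ∀ r → ℬ r → 𝒞 r

Persistent : {Atom : Set} → Base Atom → Atom → Set
Persistent {Atom} ℬ p = Σ (Box Atom) λ S → (S ≢ []) × ℬ ⟨ [] , S , p ⟩

data _⊢[_]_ {Atom : Set} : AMS Atom → Base Atom → Atom → Set₁ where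
  ref : ∀ {ℬ Γ p} → Γ ↭ (p ∷ []) → Γ ⊢[ ℬ ] p
  app : ∀ {ℬ Γ} (A : List (Box Atom)) (S : Box Atom) (p : Atom) →
        ℬ ⟨ A , S , p ⟩ →
        (Cs : List (AMS Atom)) →
        Pointwise (λ C T → ∀ {Q q} → (Q , q) ∈ T → (C ++ Q) ⊢[ ℬ ] q) Cs A →
        (Es : List (AMS Atom × Atom)) →
        All (λ e → Persistent ℬ (proj₂ e) × (proj₁ e ⊢[ ℬ ] proj₂ e)) Es →
        (∀ {U v} → (U , v) ∈ S → (map proj₂ Es ++ U) ⊢[ ℬ ] v) →
        Γ ↭ (concat Cs ++ concat (map proj₁ Es)) →
        Γ ⊢[ ℬ ] p

{-# OPTIONS --safe #-}
-- (1) ⇒ (2): derivability is monotone in the base, and cut is admissible: a derivation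
-- of T ⊢ p may replace one occurrence of p in the context of any derivation. By induction
-- on the derivation, that occurrence lies in one of the contexts C₁, …, Cₙ of the last
-- application, so the cut is pushed into the corresponding premise; the premises for the
-- box 𝐒 are never touched, as their contexts D ⊎ U do not involve the Cᵢ. Cutting the pᵢ
-- one at a time gives (2). (2) ⇒ (1): take 𝒞 = ℬ and Tᵢ = {pᵢ}.
module Submission where

open import Defs
open import Data.List using (List; []; _∷_; _++_; concat; map; [_])
open import Data.List.Properties using (++-identityʳ; concat-map-[_])
open import Data.List.Relation.Binary.Pointwise using (Pointwise; []; _∷_)
open import Data.List.Relation.Unary.All using (All; []; _∷_)
open import Data.List.Relation.Unary.Any using (here)
open import Data.List.Membership.Propositional using (_∈_)
open import Data.List.Membership.Propositional.Properties using (∈-++⁻; ∈-∃++)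
open import Data.List.Relation.Binary.Permutation.Propositional
  using (_↭_; ↭-sym; ↭-trans; ↭-refl; module PermutationReasoning)
open import Data.List.Relation.Binary.Permutation.Propositional.Properties
  using (shift; shifts; drop-∷; ++⁺ˡ; ++⁺ʳ; ++-assoc; ++-comm; ∈-resp-↭; ↭-singleton-inv)
open import Data.Product using (_×_; _,_; proj₁; proj₂; ∃)
open import Data.Sum using (inj₁; inj₂)
open import Function using (id)
open import Relation.Binary.PropositionalEquality using (_≡_; refl; sym; cong; subst)

module _ {A : Set} where

  private variable
    x : A
    xs X X′ Y Y′ R T Δ : List A

  ∈⇒↭∷ : x ∈ xs → ∃ λ xs′ → xs ↭ x ∷ xs′
  ∈⇒↭∷ {x} x∈xs with ys , zs , refl ← ∈-∃++ x∈xs = ys ++ zs , shift x ys zs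

  ↭-replaceˡ : X ++ Y ↭ x ∷ Δ → X ↭ x ∷ R → X′ ↭ T ++ R → T ++ Δ ↭ X′ ++ Y
  ↭-replaceˡ {Y = Y} {Δ = Δ} {R = R} {X′ = X′} {T = T} X++Y↭x∷Δ X↭x∷R X′↭T++R = begin
    T ++ Δ        ↭⟨ ++⁺ˡ T Δ↭R++Y ⟩
    T ++ R ++ Y   ↭⟨ ++-assoc T R Y ⟨
    (T ++ R) ++ Y ↭⟨ ++⁺ʳ Y X′↭T++R ⟨
    X′ ++ Y       ∎
    where
      open PermutationReasoning
      Δ↭R++Y : Δ ↭ R ++ Y
      Δ↭R++Y = drop-∷ (↭-trans (↭-sym X++Y↭x∷Δ) (++⁺ʳ Y X↭x∷R))

  ↭-replaceʳ : X ++ Y ↭ x ∷ Δ → Y ↭ x ∷ R → Y′ ↭ T ++ R → T ++ Δ ↭ X ++ Y′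
  ↭-replaceʳ {X = X} {Y = Y} {Y′ = Y′} X++Y↭x∷Δ Y↭x∷R Y′↭T++R =
    ↭-trans (↭-replaceˡ (↭-trans (++-comm Y X) X++Y↭x∷Δ) Y↭x∷R Y′↭T++R) (++-comm Y′ X)

  ↭-shifts : ∀ X T → Y ↭ T ++ R → X ++ Y ↭ T ++ X ++ R
  ↭-shifts X T Y↭T++R = ↭-trans (++⁺ˡ X Y↭T++R) (shifts X T)

module _ {Atom : Set} where

  private variable
    ℬ 𝒞 : Base Atom
    Γ Δ : AMS Atom
    p q : Atom

  BoxPremises : Base Atom → List (AMS Atom) → List (Box Atom) → Set₁
  BoxPremises ℬ = Pointwise (λ C 𝐓 → ∀ {Q q} → (Q , q) ∈ 𝐓 → (C ++ Q) ⊢[ ℬ ] q)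

  PersistentPremises : Base Atom → List (AMS Atom × Atom) → Set₁
  PersistentPremises ℬ = All (λ e → Persistent ℬ (proj₂ e) × (proj₁ e ⊢[ ℬ ] proj₂ e))

  ⊢-resp-↭ : Γ ⊢[ ℬ ] q → Γ ↭ Δ → Δ ⊢[ ℬ ] q
  ⊢-resp-↭ (ref Γ↭q) Γ↭Δ = ref (↭-trans (↭-sym Γ↭Δ) Γ↭q)
  ⊢-resp-↭ (app 𝐀 𝐒 p r Cs boxes Es persistents conclusions Γ↭) Γ↭Δ =
    app 𝐀 𝐒 p r Cs boxes Es persistents conclusions (↭-trans (↭-sym Γ↭Δ) Γ↭)

  Persistent-mono : 𝒞 ⊇ ℬ → Persistent ℬ p → Persistent 𝒞 p
  Persistent-mono 𝒞⊇ℬ (𝐒 , 𝐒≢[] , r) = 𝐒 , 𝐒≢[] , 𝒞⊇ℬ _ r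

  mutual
    ⊢-mono : 𝒞 ⊇ ℬ → Γ ⊢[ ℬ ] q → Γ ⊢[ 𝒞 ] q
    ⊢-mono 𝒞⊇ℬ (ref Γ↭q) = ref Γ↭q
    ⊢-mono 𝒞⊇ℬ (app 𝐀 𝐒 p r Cs boxes Es persistents conclusions Γ↭) =
      app 𝐀 𝐒 p (𝒞⊇ℬ _ r) Cs (BoxPremises-mono 𝒞⊇ℬ boxes)
        Es (PersistentPremises-mono 𝒞⊇ℬ persistents)
        (λ U⇒v∈𝐒 → ⊢-mono 𝒞⊇ℬ (conclusions U⇒v∈𝐒)) Γ↭

    BoxPremises-mono : ∀ {Cs 𝐀} → 𝒞 ⊇ ℬ → BoxPremises ℬ Cs 𝐀 → BoxPremises 𝒞 Cs 𝐀
    BoxPremises-mono 𝒞⊇ℬ [] = []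
    BoxPremises-mono 𝒞⊇ℬ (box ∷ boxes) =
      (λ Q⇒q∈𝐓 → ⊢-mono 𝒞⊇ℬ (box Q⇒q∈𝐓)) ∷ BoxPremises-mono 𝒞⊇ℬ boxes

    PersistentPremises-mono : ∀ {Es} → 𝒞 ⊇ ℬ →
                              PersistentPremises ℬ Es → PersistentPremises 𝒞 Es
    PersistentPremises-mono 𝒞⊇ℬ [] = []
    PersistentPremises-mono 𝒞⊇ℬ ((d , C⊢d) ∷ persistents) =
      (Persistent-mono 𝒞⊇ℬ d , ⊢-mono 𝒞⊇ℬ C⊢d) ∷ PersistentPremises-mono 𝒞⊇ℬ persistents

  module Cut {ℬ : Base Atom} {T : AMS Atom} {p : Atom} (T⊢p : T ⊢[ ℬ ] p) where

    record Substituted {X : Set} (atoms : List X → AMS Atom) (Valid : List X → Set₁)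
                       (xs : List X) : Set₁ where
      constructor substituted
      field
        rest   : AMS Atom
        xs′    : List X
        valid  : Valid xs′
        before : atoms xs ↭ p ∷ rest
        after  : atoms xs′ ↭ T ++ rest

    mutual
      cut : Γ ⊢[ ℬ ] q → Γ ↭ p ∷ Δ → (T ++ Δ) ⊢[ ℬ ] q
      cut (ref Γ↭q) Γ↭p∷Δ with refl ← ↭-singleton-inv (↭-trans (↭-sym Γ↭p∷Δ) Γ↭q) =
        subst (_⊢[ ℬ ] p) (sym (++-identityʳ T)) T⊢p
      cut (app 𝐀 𝐒 r r∈ℬ Cs boxes Es persistents conclusions Γ↭) Γ↭p∷Δ
        with ctx↭p∷Δ ← ↭-trans (↭-sym Γ↭) Γ↭p∷Δ
        with ∈-++⁻ (concat Cs) (∈-resp-↭ (↭-sym ctx↭p∷Δ) (here refl))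
      ... | inj₁ p∈Cs
        with substituted R Cs′ boxes′ Cs↭p∷R Cs′↭T++R ← cut-boxes boxes p∈Cs =
        app 𝐀 𝐒 r r∈ℬ Cs′ boxes′ Es persistents conclusions
          (↭-replaceˡ ctx↭p∷Δ Cs↭p∷R Cs′↭T++R)
      ... | inj₂ p∈Es
        with substituted R Es′ (persistents′ , same-atoms) Es↭p∷R Es′↭T++R
               ← cut-persistents persistents p∈Es =
        app 𝐀 𝐒 r r∈ℬ Cs boxes Es′ persistents′
          (subst (λ D → ∀ {U v} → (U , v) ∈ 𝐒 → (D ++ U) ⊢[ ℬ ] v)
                 (sym same-atoms) conclusions)
          (↭-replaceʳ ctx↭p∷Δ Es↭p∷R Es′↭T++R)

      cut-boxes : ∀ {Cs 𝐀} → BoxPremises ℬ Cs 𝐀 → p ∈ concat Cs →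
                  Substituted concat (λ Cs′ → BoxPremises ℬ Cs′ 𝐀) Cs
      cut-boxes {C ∷ Cs} {𝐓 ∷ 𝐀} (box ∷ boxes) p∈ with ∈-++⁻ C p∈
      ... | inj₁ p∈C with C′ , C↭p∷C′ ← ∈⇒↭∷ p∈C =
        substituted (C′ ++ concat Cs) ((T ++ C′) ∷ Cs) (box′ ∷ boxes)
          (++⁺ʳ (concat Cs) C↭p∷C′) (++-assoc T C′ (concat Cs))
        where
          box′ : ∀ {Q q} → (Q , q) ∈ 𝐓 → ((T ++ C′) ++ Q) ⊢[ ℬ ] q
          box′ {Q} Q⇒q∈𝐓 =
            ⊢-resp-↭ (cut (box Q⇒q∈𝐓) (++⁺ʳ Q C↭p∷C′)) (↭-sym (++-assoc T C′ Q))
      ... | inj₂ p∈Cs with substituted R Cs′ boxes′ Cs↭p∷R Cs′↭T++R ← cut-boxes boxes p∈Cs =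
        substituted (C ++ R) (C ∷ Cs′) (box ∷ boxes′)
          (↭-shifts C [ p ] Cs↭p∷R) (↭-shifts C T Cs′↭T++R)

      cut-persistents : ∀ {Es} → PersistentPremises ℬ Es → p ∈ concat (map proj₁ Es) →
                        Substituted (λ Es → concat (map proj₁ Es))
                          (λ Es′ → PersistentPremises ℬ Es′ × map proj₂ Es′ ≡ map proj₂ Es) Es
      cut-persistents {(C , d) ∷ Es} ((persistent , C⊢d) ∷ persistents) p∈ with ∈-++⁻ C p∈
      ... | inj₁ p∈C with C′ , C↭p∷C′ ← ∈⇒↭∷ p∈C =
        substituted (C′ ++ concat (map proj₁ Es)) ((T ++ C′ , d) ∷ Es)
          ((persistent , cut C⊢d C↭p∷C′) ∷ persistents , refl)
          (++⁺ʳ _ C↭p∷C′) (++-assoc T C′ _)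
      ... | inj₂ p∈Es
        with substituted R Es′ (persistents′ , same-atoms) Es↭p∷R Es′↭T++R
               ← cut-persistents persistents p∈Es =
        substituted (C ++ R) ((C , d) ∷ Es′)
          ((persistent , C⊢d) ∷ persistents′ , cong (d ∷_) same-atoms)
          (↭-shifts C [ p ] Es↭p∷R) (↭-shifts C T Es′↭T++R)

  open Cut using (cut)

  cut-each : ∀ {P S Ts} → (P ++ S) ⊢[ ℬ ] q → Pointwise (λ T p → T ⊢[ ℬ ] p) Ts P →
             (concat Ts ++ S) ⊢[ ℬ ] q
  cut-each P++S⊢q [] = P++S⊢q
  cut-each {ℬ} {q} {p ∷ P} {S} {T ∷ Ts} p∷P++S⊢q (T⊢p ∷ Ts⊢P) =
    ⊢-resp-↭ (cut T⊢p Ts++p∷S⊢q (shift p (concat Ts) S)) (↭-sym (++-assoc T (concat Ts) S))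
    where
      Ts++p∷S⊢q : (concat Ts ++ p ∷ S) ⊢[ ℬ ] q
      Ts++p∷S⊢q = cut-each (⊢-resp-↭ p∷P++S⊢q (↭-sym (shift p P S))) Ts⊢P

  ref-each : ∀ P → Pointwise (λ T p → T ⊢[ ℬ ] p) (map [_] P) P
  ref-each []      = []
  ref-each (p ∷ P) = ref ↭-refl ∷ ref-each P

mainTheorem5 : {Atom : Set} (ℬ : Base Atom) (S : AMS Atom) (q : Atom) (P : AMS Atom) →
    ((P ++ S) ⊢[ ℬ ] q →
      ∀ (𝒞 : Base Atom) → 𝒞 ⊇ ℬ → (Ts : List (AMS Atom)) →
        Pointwise (λ T p → T ⊢[ 𝒞 ] p) Ts P → (concat Ts ++ S) ⊢[ 𝒞 ] q)
    × ((∀ (𝒞 : Base Atom) → 𝒞 ⊇ ℬ → (Ts : List (AMS Atom)) →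
        Pointwise (λ T p → T ⊢[ 𝒞 ] p) Ts P → (concat Ts ++ S) ⊢[ 𝒞 ] q) →
      (P ++ S) ⊢[ ℬ ] q)
mainTheorem5 ℬ S q P =
  (λ P++S⊢q 𝒞 𝒞⊇ℬ Ts Ts⊢P → cut-each (⊢-mono 𝒞⊇ℬ P++S⊢q) Ts⊢P) ,
  (λ cut-admissible → subst (λ X → (X ++ S) ⊢[ ℬ ] q) (concat-map-[ P ])
                        (cut-admissible ℬ (λ _ → id) (map [_] P) (ref-each P)))
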